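{- For each positive integer $d$, there exists a finite tree satisfying the neighbour sum property whose solution space has dimension exactly $d$.
   Context: For a finite graph $\mathcal G=(\mathcal V,\mathcal E)$, its solution space is the real vector space of all functions $f:\mathcal V\to\mathbb R$ satisfying $f(x)=\sum_{y:\{x,y\}\in\mathcal E} f(y)$ for every $x\in\mathcal V$. The graph satisfies the neighbour sum property if this space contains some $f\not\equiv 0$.
   Formalization: The functions in the solution space take values in ℚ in place of ℝ, so the solution space is a vector space over the rationals and its dimension is counted over ℚ. -}

module Defs where

open import Data.Nat using (ℕ; zero; suc; _≤_; _<_)
open import Data.Fin using (Fin)
open import Data.Bool using (Bool; true; false)
open import Data.List using (List; []; _∷_; length)
open import Data.List.Relation.Unary.Unique.Propositional using (Unique)
open import Data.Rational using (ℚ; 0ℚ; _+_; _*_)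
open import Data.Product using (Σ; _×_; _,_; ∃)
open import Relation.Binary.PropositionalEquality using (_≡_)
open import Relation.Nullary using (¬_)
open import Data.Empty using (⊥)
open import Data.Unit using (⊤)

record Graph (n : ℕ) : Set where
  field
    adj       : Fin n → Fin n → Bool
    symmetric : ∀ x y → adj x y ≡ adj y x
    irrefl    : ∀ x → adj x x ≡ false

open Graph public

sumFin : (n : ℕ) → (Fin n → ℚ) → ℚ
sumFin zero    f = 0ℚ
sumFin (suc n) f = f Fin.zero + sumFin n (λ i → f (Fin.suc i))

[_] : Bool → ℚ
[ true ]  = Data.Rational.1ℚ
[ false ] = 0ℚ

IsWalk : ∀ {n} → Graph n → List (Fin n) → Set
IsWalk G []            = ⊤
IsWalk G (x ∷ [])      = ⊤
IsWalk G (x ∷ y ∷ xs)  = (adj G x y ≡ true) × IsWalk G (y ∷ xs)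

head? : ∀ {A : Set} → A → List A → A
head? d []      = d
head? d (x ∷ _) = x

last? : ∀ {A : Set} → A → List A → A
last? d []          = d
last? d (x ∷ [])    = x
last? d (_ ∷ y ∷ l) = last? d (y ∷ l)

Connected : ∀ {n} → Graph n → Set
Connected {n} G = ∀ (x y : Fin n) → Σ (List (Fin n)) λ w →
  IsWalk G (x ∷ w) × last? x (x ∷ w) ≡ y

IsCycle : ∀ {n} → Graph n → List (Fin n) → Set
IsCycle G []          = ⊥
IsCycle G (x ∷ xs)    =
  (3 ≤ length (x ∷ xs)) × Unique (x ∷ xs) × IsWalk G (x ∷ xs) × (adj G (last? x (x ∷ xs)) x ≡ true)

Acyclic : ∀ {n} → Graph n → Set
Acyclic {n} G = ∀ (c : List (Fin n)) → ¬ IsCycle G c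

IsTree : ∀ {n} → Graph n → Set
IsTree {n} G = (0 < n) × Connected G × Acyclic G

IsSolution : ∀ {n} → Graph n → (Fin n → ℚ) → Set
IsSolution {n} G f = ∀ x → f x ≡ sumFin n (λ y → [ adj G x y ] * f y)

NSP : ∀ {n} → Graph n → Set
NSP {n} G = Σ (Fin n → ℚ) λ f → IsSolution G f × ∃ λ x → ¬ (f x ≡ 0ℚ)

lincomb : ∀ {n} d → (Fin d → ℚ) → (Fin d → Fin n → ℚ) → Fin n → ℚ
lincomb d c b x = sumFin d (λ i → c i * b i x)

SolutionDim : ∀ {n} → Graph n → ℕ → Set
SolutionDim {n} G d = Σ (Fin d → Fin n → ℚ) λ b →
    (∀ i → IsSolution G (b i))
  × (∀ (c : Fin d → ℚ) → (∀ x → lincomb d c b x ≡ 0ℚ) → ∀ i → c i ≡ 0ℚ)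
  × (∀ (f : Fin n → ℚ) → IsSolution G f →
       Σ (Fin d → ℚ) λ c → ∀ x → f x ≡ lincomb d c b x)

{-# OPTIONS --safe #-}

-- The witness is the spider with d + 1 legs of length two: a hub joined to d + 1 inner
-- vertices, each carrying one outer leaf. In a solution every leaf copies its inner
-- neighbour, so the equation at an inner vertex forces the value 0 at the hub, and the
-- equation at the hub then says that the inner values sum to 0. Conversely every
-- zero-sum assignment to the legs is a solution, so the solution space is the zero-sum
-- hyperplane of ℚ^(d+1), with basis e_(j+1) − e_0.
-- The spider is a tree because each edge joins a vertex to its parent one level nearer
-- the hub: on a cycle, both neighbours of a highest vertex would be its parent.

module Submission where

open import Defs
open import Data.Nat as ℕ using (ℕ; zero; suc; _≤_; _<_; s≤s; z≤n)
open import Data.Nat.Properties using (<⇒≱; n<1+n)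
open import Data.Fin using (Fin; zero; suc; _↑ˡ_; _↑ʳ_; splitAt)
open import Data.Fin.Properties
  using (_≟_; splitAt-↑ˡ; splitAt-↑ʳ; splitAt⁻¹-↑ˡ; splitAt⁻¹-↑ʳ; ¬∀⟶∃¬)
open import Data.Rational using (ℚ; 0ℚ; 1ℚ; -_; _+_; _*_)
import Data.Rational.Properties as ℚ
import Algebra.Properties.Group as GroupProperties
open import Data.Bool using (Bool; true; false)
open import Data.Sum using (_⊎_; inj₁; inj₂; [_,_]′)
import Data.Sum as Sum
open import Data.Product using (Σ; _×_; _,_; map₁)
open import Data.Unit using (tt)
open import Data.Empty using (⊥)
open import Data.List using (List; []; _∷_; _++_; _∷ʳ_; map)
open import Data.List.Properties using (++-assoc; ++-identityʳ)
open import Data.List.Membership.Propositional using (_∈_)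
open import Data.List.Membership.Propositional.Properties using (∈-∃++)
open import Data.List.Relation.Unary.Any using (here; there)
open import Data.List.Relation.Unary.All using (All; _∷_)
import Data.List.Relation.Unary.All as All
import Data.List.Relation.Unary.All.Properties as All
open import Data.List.Relation.Unary.AllPairs using (_∷_)
open import Data.List.Relation.Unary.Linked using (Linked; [-]; _∷_)
open import Data.List.Relation.Binary.Permutation.Propositional using (_↭_; ↭⇒↭ₛ)
open import Data.List.Relation.Binary.Permutation.Propositional.Properties
  using (↭-length; ∷↭∷ʳ)
import Data.List.Relation.Binary.Permutation.Setoid.Properties as Permutation
open import Data.List.Extrema.Nat
  using (argmax; argmax-sel; f[⊥]≤f[argmax]; f[xs]≤f[argmax])
open import Relation.Binary.PropositionalEquality
  using (_≡_; refl; sym; trans; cong; cong₂; subst; subst₂; setoid; module ≡-Reasoning)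
open import Relation.Nullary using (¬_; does; contradiction; yes; no)
open import Relation.Nullary.Decidable using (dec-true; does-⇔)
open import Function using (_∘_; mk⇔)

open ≡-Reasoning
open GroupProperties ℚ.+-0-group using (identityˡ-unique; inverseˡ-unique)

≟-does-sym : ∀ {n} (i j : Fin n) → does (i ≟ j) ≡ does (j ≟ i)
≟-does-sym i j = does-⇔ (mk⇔ sym sym) (i ≟ j) (j ≟ i)

≟-does-true : ∀ {n} {i j : Fin n} → does (i ≟ j) ≡ true → i ≡ j
≟-does-true {i = i} {j} e with i ≟ j
... | yes i≡j = i≡j
... | no _    = contradiction e λ ()

sumFin-cong : ∀ n {f g : Fin n → ℚ} → (∀ i → f i ≡ g i) → sumFin n f ≡ sumFin n g
sumFin-cong zero    f≗g = refl
sumFin-cong (suc n) f≗g = cong₂ _+_ (f≗g zero) (sumFin-cong n (f≗g ∘ suc))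

sumFin-zero : ∀ n {f : Fin n → ℚ} → (∀ i → f i ≡ 0ℚ) → sumFin n f ≡ 0ℚ
sumFin-zero zero    f≗0 = refl
sumFin-zero (suc n) f≗0 = cong₂ _+_ (f≗0 zero) (sumFin-zero n (f≗0 ∘ suc))

sumFin-0* : ∀ n (g : Fin n → ℚ) → sumFin n (λ k → 0ℚ * g k) ≡ 0ℚ
sumFin-0* n g = sumFin-zero n (λ k → ℚ.*-zeroˡ (g k))

sumFin-++ : ∀ m k (h : Fin (m ℕ.+ k) → ℚ) →
  sumFin (m ℕ.+ k) h ≡ sumFin m (λ i → h (i ↑ˡ k)) + sumFin k (λ j → h (m ↑ʳ j))
sumFin-++ zero    k h = sym (ℚ.+-identityˡ (sumFin k h))
sumFin-++ (suc m) k h = begin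
  h zero + sumFin (m ℕ.+ k) (h ∘ suc)
    ≡⟨ cong (h zero +_) (sumFin-++ m k (h ∘ suc)) ⟩
  h zero + (sumFin m (λ i → h (suc (i ↑ˡ k))) + sumFin k (λ j → h (suc (m ↑ʳ j))))
    ≡⟨ ℚ.+-assoc (h zero) _ _ ⟨
  h zero + sumFin m (λ i → h (suc (i ↑ˡ k))) + sumFin k (λ j → h (suc (m ↑ʳ j))) ∎

sumFin-*ʳ : ∀ n (f : Fin n → ℚ) x → sumFin n (λ i → f i * x) ≡ sumFin n f * x
sumFin-*ʳ zero    f x = sym (ℚ.*-zeroˡ x)
sumFin-*ʳ (suc n) f x = begin
  f zero * x + sumFin n (λ i → f (suc i) * x)
    ≡⟨ cong (f zero * x +_) (sumFin-*ʳ n (f ∘ suc) x) ⟩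
  f zero * x + sumFin n (f ∘ suc) * x
    ≡⟨ ℚ.*-distribʳ-+ x (f zero) _ ⟨
  (f zero + sumFin n (f ∘ suc)) * x ∎

sumFin-δ : ∀ n (i : Fin n) (g : Fin n → ℚ) →
           sumFin n (λ k → [ does (i ≟ k) ] * g k) ≡ g i
sumFin-δ (suc n) zero g = begin
  1ℚ * g zero + sumFin n (λ k → 0ℚ * g (suc k))
    ≡⟨ cong₂ _+_ (ℚ.*-identityˡ (g zero)) (sumFin-0* n (g ∘ suc)) ⟩
  g zero + 0ℚ
    ≡⟨ ℚ.+-identityʳ (g zero) ⟩
  g zero ∎
sumFin-δ (suc n) (suc i) g = begin
  0ℚ * g zero + sumFin n (λ k → [ does (i ≟ k) ] * g (suc k))
    ≡⟨ cong₂ _+_ (ℚ.*-zeroˡ (g zero)) (sumFin-δ n i (g ∘ suc)) ⟩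
  0ℚ + g (suc i)
    ≡⟨ ℚ.+-identityˡ (g (suc i)) ⟩
  g (suc i) ∎

sumFin-δʳ : ∀ n (k : Fin n) (g : Fin n → ℚ) →
            sumFin n (λ j → g j * [ does (j ≟ k) ]) ≡ g k
sumFin-δʳ n k g = trans (sumFin-cong n commute) (sumFin-δ n k g)
  where
  commute : ∀ j → g j * [ does (j ≟ k) ] ≡ [ does (k ≟ j) ] * g j
  commute j = trans (ℚ.*-comm (g j) _) (cong (λ b → [ b ] * g j) (≟-does-sym j k))

zeroSumBasis : ∀ {d} → Fin d → Fin (suc d) → ℚ
zeroSumBasis j zero    = - 1ℚ
zeroSumBasis j (suc k) = [ does (j ≟ k) ]

sum-zeroSumBasis : ∀ {d} (j : Fin d) → sumFin (suc d) (zeroSumBasis j) ≡ 0ℚ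
sum-zeroSumBasis {d} j = begin
  - 1ℚ + sumFin d (λ k → [ does (j ≟ k) ])
    ≡⟨ cong (- 1ℚ +_) (sumFin-cong d (λ k → ℚ.*-identityʳ [ does (j ≟ k) ])) ⟨
  - 1ℚ + sumFin d (λ k → [ does (j ≟ k) ] * 1ℚ)
    ≡⟨ cong (- 1ℚ +_) (sumFin-δ d j (λ _ → 1ℚ)) ⟩
  - 1ℚ + 1ℚ
    ≡⟨ ℚ.+-inverseˡ 1ℚ ⟩
  0ℚ ∎

lincomb-zeroSumBasis-suc : ∀ d c (k : Fin d) → lincomb d c zeroSumBasis (suc k) ≡ c k
lincomb-zeroSumBasis-suc d c k = sumFin-δʳ d k c

zeroSumBasis-independent : ∀ d (c : Fin d → ℚ) →
  (∀ x → lincomb d c zeroSumBasis x ≡ 0ℚ) → ∀ k → c k ≡ 0ℚ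
zeroSumBasis-independent d c c·b≡0 k =
  trans (sym (lincomb-zeroSumBasis-suc d c k)) (c·b≡0 (suc k))

zeroSumBasis-spans : ∀ d (a : Fin (suc d) → ℚ) → sumFin (suc d) a ≡ 0ℚ →
  ∀ x → a x ≡ lincomb d (a ∘ suc) zeroSumBasis x
zeroSumBasis-spans d a Σa≡0 zero = begin
  a zero                                ≡⟨ inverseˡ-unique (a zero) _ Σa≡0 ⟩
  - sumFin d (a ∘ suc)                  ≡⟨ cong -_ (ℚ.*-identityʳ _) ⟨
  - (sumFin d (a ∘ suc) * 1ℚ)           ≡⟨ ℚ.neg-distribʳ-* (sumFin d (a ∘ suc)) 1ℚ ⟩
  sumFin d (a ∘ suc) * - 1ℚ             ≡⟨ sumFin-*ʳ d (a ∘ suc) (- 1ℚ) ⟨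
  lincomb d (a ∘ suc) zeroSumBasis zero ∎
zeroSumBasis-spans d a _ (suc k) = sym (lincomb-zeroSumBasis-suc d (a ∘ suc) k)

SolutionDim⇒NSP : ∀ {n d} {G : Graph n} → SolutionDim G (suc d) → NSP G
SolutionDim⇒NSP {n} {d} (b , solves , independent , _) =
  b zero , solves zero , ¬∀⟶∃¬ n _ (λ x → b zero x ℚ.≟ 0ℚ) b₀≢0
  where
  b₀≢0 : ¬ (∀ x → b zero x ≡ 0ℚ)
  b₀≢0 b₀≡0 = ℚ.1≢0 (independent (λ j → [ does (zero ≟ j) ])
    (λ x → trans (sumFin-δ (suc d) zero (λ j → b j x)) (b₀≡0 x)) zero)

last?-∷ʳ : ∀ {A : Set} (d : A) xs x → last? d (xs ∷ʳ x) ≡ x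
last?-∷ʳ d []           x = refl
last?-∷ʳ d (y ∷ [])     x = refl
last?-∷ʳ d (y ∷ z ∷ zs) x = last?-∷ʳ d (z ∷ zs) x

last?-∈ : ∀ {A : Set} (d x : A) xs → last? d (x ∷ xs) ∈ x ∷ xs
last?-∈ d x []       = here refl
last?-∈ d x (y ∷ ys) = there (last?-∈ d y ys)

last?-map : ∀ {A B : Set} (f : A → B) d xs → last? (f d) (map f xs) ≡ f (last? d xs)
last?-map f d []           = refl
last?-map f d (x ∷ [])     = refl
last?-map f d (x ∷ y ∷ xs) = last?-map f d (y ∷ xs)

module _ {n} {G : Graph n} where

  IsWalk-∷ʳ : ∀ d y ys x → IsWalk G (y ∷ ys) → adj G (last? d (y ∷ ys)) x ≡ true →
              IsWalk G ((y ∷ ys) ∷ʳ x)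
  IsWalk-∷ʳ d y []       x _         y~x = y~x , tt
  IsWalk-∷ʳ d y (z ∷ zs) x (y~z , w) z~x = y~z , IsWalk-∷ʳ d z zs x w z~x

  IsCycle-rotate : ∀ x xs → IsCycle G (x ∷ xs) → IsCycle G (xs ∷ʳ x)
  IsCycle-rotate x []       (s≤s () , _)
  IsCycle-rotate x (y ∷ ys) (long , unique , (x~y , walk) , y~x) =
    subst (3 ≤_) (↭-length x∷xs↭xs∷ʳx) long ,
    Permutation.Unique-resp-↭ (setoid (Fin n)) (↭⇒↭ₛ x∷xs↭xs∷ʳx) unique ,
    IsWalk-∷ʳ x y ys x walk y~x ,
    subst (λ z → adj G z y ≡ true) (sym (last?-∷ʳ y (y ∷ ys) x)) x~y
    where
    x∷xs↭xs∷ʳx : x ∷ y ∷ ys ↭ (y ∷ ys) ∷ʳ x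
    x∷xs↭xs∷ʳx = ∷↭∷ʳ x (y ∷ ys)

  IsCycle-rotateTo : ∀ xs v ys → IsCycle G (xs ++ v ∷ ys) → IsCycle G (v ∷ ys ++ xs)
  IsCycle-rotateTo []       v ys c = subst (λ l → IsCycle G (v ∷ l)) (sym (++-identityʳ ys)) c
  IsCycle-rotateTo (x ∷ xs) v ys c =
    subst (λ l → IsCycle G (v ∷ l)) (++-assoc ys (x ∷ []) xs)
      (IsCycle-rotateTo xs v (ys ∷ʳ x)
        (subst (IsCycle G) (++-assoc xs (v ∷ ys) (x ∷ []))
          (IsCycle-rotate x (xs ++ v ∷ ys) c)))

record Rooting {n} (G : Graph n) : Set where
  field
    height         : Fin n → ℕ
    parent         : Fin n → Fin n
    edge-to-parent : ∀ {x y} → adj G x y ≡ true →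
      (x ≡ parent y × height x < height y) ⊎ (y ≡ parent x × height y < height x)

  lower-neighbour-is-parent : ∀ {x y} → adj G x y ≡ true → height y ≤ height x →
                              y ≡ parent x
  lower-neighbour-is-parent x~y y≤x with edge-to-parent x~y
  ... | inj₁ (_ , x<y)  = contradiction y≤x (<⇒≱ x<y)
  ... | inj₂ (y≡px , _) = y≡px

module _ {n} {G : Graph n} (R : Rooting G) where
  open Rooting R

  summit-cannot-head-cycle : ∀ v ys → IsCycle G (v ∷ ys) →
                             All (λ y → height y ≤ height v) ys → ⊥
  summit-cannot-head-cycle v []            (s≤s () , _) _
  summit-cannot-head-cycle v (y ∷ [])      (s≤s (s≤s ()) , _) _
  summit-cannot-head-cycle v (y ∷ y′ ∷ ys)
                           (_ , (_ ∷ y∉ ∷ _) , (v~y , _) , w~v) (y≤v ∷ below) =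
    All.lookup y∉ w∈ (trans (lower-neighbour-is-parent v~y y≤v)
                            (sym (lower-neighbour-is-parent v~w (All.lookup below w∈))))
    where
    w∈ : last? v (y′ ∷ ys) ∈ y′ ∷ ys
    w∈ = last?-∈ v y′ ys
    v~w : adj G v (last? v (y′ ∷ ys)) ≡ true
    v~w = trans (symmetric G v _) w~v

  summit-not-on-cycle : ∀ {c v} → IsCycle G c → v ∈ c →
                        All (λ y → height y ≤ height v) c → ⊥
  summit-not-on-cycle {c} {v} cycle v∈c below with ∈-∃++ v∈c
  ... | xs , ys , refl with All.++⁻ xs below
  ...   | below-xs , _ ∷ below-ys =
    summit-cannot-head-cycle v (ys ++ xs) (IsCycle-rotateTo xs v ys cycle)
                             (All.++⁺ below-ys below-xs)

  Rooting⇒Acyclic : Acyclic G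
  Rooting⇒Acyclic []       ()
  Rooting⇒Acyclic (x ∷ xs) cycle = summit-not-on-cycle cycle summit∈
    (f[⊥]≤f[argmax] {f = height} x xs ∷ f[xs]≤f[argmax] {f = height} x xs)
    where
    summit∈ : argmax height x xs ∈ x ∷ xs
    summit∈ = Sum.[ here , there ]′ (argmax-sel height x xs)

data SpiderVertex (m : ℕ) : Set where
  hub   : SpiderVertex m
  inner : Fin m → SpiderVertex m
  outer : Fin m → SpiderVertex m

module Spider (m : ℕ) where

  _⇌_ : SpiderVertex m → SpiderVertex m → Bool
  hub     ⇌ inner _ = true
  inner _ ⇌ hub     = true
  inner i ⇌ outer j = does (i ≟ j)
  outer i ⇌ inner j = does (i ≟ j)
  _       ⇌ _       = false

  ⇌-sym : ∀ u v → u ⇌ v ≡ v ⇌ u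
  ⇌-sym hub       hub       = refl
  ⇌-sym hub       (inner _) = refl
  ⇌-sym hub       (outer _) = refl
  ⇌-sym (inner _) hub       = refl
  ⇌-sym (inner _) (inner _) = refl
  ⇌-sym (inner i) (outer j) = ≟-does-sym i j
  ⇌-sym (outer _) hub       = refl
  ⇌-sym (outer i) (inner j) = ≟-does-sym i j
  ⇌-sym (outer _) (outer _) = refl

  ⇌-irrefl : ∀ u → u ⇌ u ≡ false
  ⇌-irrefl hub       = refl
  ⇌-irrefl (inner _) = refl
  ⇌-irrefl (outer _) = refl

  height : SpiderVertex m → ℕ
  height hub       = 0
  height (inner _) = 1
  height (outer _) = 2

  parent : SpiderVertex m → SpiderVertex m
  parent hub       = hub
  parent (inner _) = hub
  parent (outer i) = inner i

  ⇌-parent : ∀ {u v} → u ⇌ v ≡ true →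
    (u ≡ parent v × height u < height v) ⊎ (v ≡ parent u × height v < height u)
  ⇌-parent {hub}     {inner _} _   = inj₁ (refl , n<1+n 0)
  ⇌-parent {inner _} {hub}     _   = inj₂ (refl , n<1+n 0)
  ⇌-parent {inner _} {outer _} i≟j = inj₁ (cong inner (≟-does-true i≟j) , n<1+n 1)
  ⇌-parent {outer _} {inner _} i≟j = inj₂ (cong inner (sym (≟-does-true i≟j)) , n<1+n 1)
  ⇌-parent {hub}     {hub}     ()
  ⇌-parent {hub}     {outer _} ()
  ⇌-parent {inner _} {inner _} ()
  ⇌-parent {outer _} {hub}     ()
  ⇌-parent {outer _} {outer _} ()

  _~_ : SpiderVertex m → SpiderVertex m → Set
  u ~ v = u ⇌ v ≡ true

  inner~outer : ∀ i → inner i ~ outer i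
  inner~outer i = dec-true (i ≟ i) refl

  outer~inner : ∀ i → outer i ~ inner i
  outer~inner i = dec-true (i ≟ i) refl

  path : ∀ u v → Σ (List (SpiderVertex m)) λ w →
         Linked _~_ (u ∷ w) × last? u (u ∷ w) ≡ v
  path hub       hub       = [] , [-] , refl
  path hub       (inner j) = inner j ∷ [] , refl ∷ [-] , refl
  path hub       (outer j) = inner j ∷ outer j ∷ [] , refl ∷ inner~outer j ∷ [-] , refl
  path (inner i) hub       = hub ∷ [] , refl ∷ [-] , refl
  path (inner i) (inner j) = hub ∷ inner j ∷ [] , refl ∷ refl ∷ [-] , refl
  path (inner i) (outer j) =
    hub ∷ inner j ∷ outer j ∷ [] , refl ∷ refl ∷ inner~outer j ∷ [-] , refl
  path (outer i) hub       = inner i ∷ hub ∷ [] , outer~inner i ∷ refl ∷ [-] , refl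
  path (outer i) (inner j) =
    inner i ∷ hub ∷ inner j ∷ [] , outer~inner i ∷ refl ∷ refl ∷ [-] , refl
  path (outer i) (outer j) =
    inner i ∷ hub ∷ inner j ∷ outer j ∷ [] ,
    outer~inner i ∷ refl ∷ refl ∷ inner~outer j ∷ [-] , refl

  N : ℕ
  N = suc (m ℕ.+ m)

  encode : SpiderVertex m → Fin N
  encode hub       = zero
  encode (inner i) = suc (i ↑ˡ m)
  encode (outer i) = suc (m ↑ʳ i)

  decode : Fin N → SpiderVertex m
  decode zero    = hub
  decode (suc k) = [ inner , outer ]′ (splitAt m k)

  decode-encode : ∀ u → decode (encode u) ≡ u
  decode-encode hub       = refl
  decode-encode (inner i) = cong [ inner , outer ]′ (splitAt-↑ˡ m i m)
  decode-encode (outer i) = cong [ inner , outer ]′ (splitAt-↑ʳ m m i)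

  encode-decode : ∀ x → encode (decode x) ≡ x
  encode-decode zero = refl
  encode-decode (suc k) with splitAt m k in eq
  ... | inj₁ i = cong suc (splitAt⁻¹-↑ˡ eq)
  ... | inj₂ i = cong suc (splitAt⁻¹-↑ʳ eq)

  decode≡⇒≡encode : ∀ {x u} → decode x ≡ u → x ≡ encode u
  decode≡⇒≡encode {x} eq = trans (sym (encode-decode x)) (cong encode eq)

  spider : Graph N
  spider = record
    { adj       = λ x y → decode x ⇌ decode y
    ; symmetric = λ x y → ⇌-sym (decode x) (decode y)
    ; irrefl    = λ x → ⇌-irrefl (decode x)
    }

  spider-rooting : Rooting spider
  spider-rooting = record
    { height         = height ∘ decode
    ; parent         = encode ∘ parent ∘ decode
    ; edge-to-parent =
        Sum.map (map₁ decode≡⇒≡encode) (map₁ decode≡⇒≡encode) ∘ ⇌-parent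
    }

  walk-encode : ∀ {u w} → Linked _~_ (u ∷ w) → IsWalk spider (map encode (u ∷ w))
  walk-encode             [-]          = tt
  walk-encode {u} {v ∷ _} (u~v ∷ walk) =
    subst₂ _~_ (sym (decode-encode u)) (sym (decode-encode v)) u~v , walk-encode walk

  spider-connected : Connected spider
  spider-connected x y with path (decode x) (decode y)
  ... | w , walk , ends =
    map encode w ,
    subst (λ z → IsWalk spider (z ∷ map encode w) × last? z (z ∷ map encode w) ≡ y)
          (encode-decode x)
          (walk-encode walk , (begin
             last? (encode (decode x)) (map encode (decode x ∷ w))
               ≡⟨ last?-map encode (decode x) (decode x ∷ w) ⟩
             encode (last? (decode x) (decode x ∷ w))
               ≡⟨ cong encode ends ⟩
             encode (decode y)
               ≡⟨ encode-decode y ⟩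
             y ∎))

  spider-tree : IsTree spider
  spider-tree = s≤s z≤n , spider-connected , Rooting⇒Acyclic spider-rooting

  sumV : (SpiderVertex m → ℚ) → ℚ
  sumV F = F hub + (sumFin m (F ∘ inner) + sumFin m (F ∘ outer))

  sumV-cong : ∀ {F G : SpiderVertex m → ℚ} → (∀ u → F u ≡ G u) → sumV F ≡ sumV G
  sumV-cong F≗G = cong₂ _+_ (F≗G hub)
    (cong₂ _+_ (sumFin-cong m (F≗G ∘ inner)) (sumFin-cong m (F≗G ∘ outer)))

  sumFin-decode : ∀ (F : SpiderVertex m → ℚ) → sumFin N (F ∘ decode) ≡ sumV F
  sumFin-decode F = trans (cong (F hub +_) (sumFin-++ m m (F ∘ decode ∘ suc)))
                          (sumV-cong (cong F ∘ decode-encode))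

  neighbourSum : SpiderVertex m → (SpiderVertex m → ℚ) → ℚ
  neighbourSum u F = sumV (λ v → [ u ⇌ v ] * F v)

  IsSpiderSolution : (SpiderVertex m → ℚ) → Set
  IsSpiderSolution F = ∀ u → F u ≡ neighbourSum u F

  solution-decode : ∀ {F} → IsSpiderSolution F → IsSolution spider (F ∘ decode)
  solution-decode {F} solves x =
    trans (solves (decode x)) (sym (sumFin-decode (λ v → [ decode x ⇌ v ] * F v)))

  solution-encode : ∀ {f} → IsSolution spider f → IsSpiderSolution (f ∘ encode)
  solution-encode {f} solves u = begin
    f (encode u)
      ≡⟨ solves (encode u) ⟩
    sumFin N (λ y → [ decode (encode u) ⇌ decode y ] * f y)
      ≡⟨ sumFin-cong N (λ y → cong (λ z → [ decode (encode u) ⇌ decode y ] * f z)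
                                   (sym (encode-decode y))) ⟩
    sumFin N (λ y → [ decode (encode u) ⇌ decode y ] * f (encode (decode y)))
      ≡⟨ sumFin-decode (λ v → [ decode (encode u) ⇌ v ] * f (encode v)) ⟩
    neighbourSum (decode (encode u)) (f ∘ encode)
      ≡⟨ cong (λ w → neighbourSum w (f ∘ encode)) (decode-encode u) ⟩
    neighbourSum u (f ∘ encode) ∎

  neighbourSum-hub : ∀ F → neighbourSum hub F ≡ sumFin m (F ∘ inner)
  neighbourSum-hub F = begin
    0ℚ * F hub + (sumFin m (λ i → 1ℚ * F (inner i)) + sumFin m (λ i → 0ℚ * F (outer i)))
      ≡⟨ cong₂ _+_ (ℚ.*-zeroˡ (F hub))
                   (cong₂ _+_ (sumFin-cong m (λ i → ℚ.*-identityˡ (F (inner i))))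
                              (sumFin-0* m (F ∘ outer))) ⟩
    0ℚ + (sumFin m (F ∘ inner) + 0ℚ)
      ≡⟨ trans (ℚ.+-identityˡ _) (ℚ.+-identityʳ _) ⟩
    sumFin m (F ∘ inner) ∎

  neighbourSum-inner : ∀ i F → neighbourSum (inner i) F ≡ F hub + F (outer i)
  neighbourSum-inner i F = begin
    1ℚ * F hub + (sumFin m (λ k → 0ℚ * F (inner k))
                  + sumFin m (λ k → [ does (i ≟ k) ] * F (outer k)))
      ≡⟨ cong₂ _+_ (ℚ.*-identityˡ (F hub))
                   (cong₂ _+_ (sumFin-0* m (F ∘ inner)) (sumFin-δ m i (F ∘ outer))) ⟩
    F hub + (0ℚ + F (outer i))
      ≡⟨ cong (F hub +_) (ℚ.+-identityˡ (F (outer i))) ⟩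
    F hub + F (outer i) ∎

  neighbourSum-outer : ∀ i F → neighbourSum (outer i) F ≡ F (inner i)
  neighbourSum-outer i F = begin
    0ℚ * F hub + (sumFin m (λ k → [ does (i ≟ k) ] * F (inner k))
                  + sumFin m (λ k → 0ℚ * F (outer k)))
      ≡⟨ cong₂ _+_ (ℚ.*-zeroˡ (F hub))
                   (cong₂ _+_ (sumFin-δ m i (F ∘ inner)) (sumFin-0* m (F ∘ outer))) ⟩
    0ℚ + (F (inner i) + 0ℚ)
      ≡⟨ trans (ℚ.+-identityˡ _) (ℚ.+-identityʳ (F (inner i))) ⟩
    F (inner i) ∎

  legs : (Fin m → ℚ) → SpiderVertex m → ℚ
  legs a hub       = 0ℚ
  legs a (inner i) = a i
  legs a (outer i) = a i

  legs-cong : ∀ {a b} → (∀ i → a i ≡ b i) → ∀ u → legs a u ≡ legs b u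
  legs-cong a≗b hub       = refl
  legs-cong a≗b (inner i) = a≗b i
  legs-cong a≗b (outer i) = a≗b i

  legs-solution : ∀ {a} → sumFin m a ≡ 0ℚ → IsSpiderSolution (legs a)
  legs-solution {a} Σa≡0 hub       = sym (trans (neighbourSum-hub (legs a)) Σa≡0)
  legs-solution {a} _    (inner i) =
    sym (trans (neighbourSum-inner i (legs a)) (ℚ.+-identityˡ (a i)))
  legs-solution {a} _    (outer i) = sym (neighbourSum-outer i (legs a))

  solution-outer : ∀ {F} → IsSpiderSolution F → ∀ i → F (outer i) ≡ F (inner i)
  solution-outer {F} solves i = trans (solves (outer i)) (neighbourSum-outer i F)

module SpiderSolutions (d : ℕ) where
  open Spider (suc d) public

  solution-hub : ∀ {F} → IsSpiderSolution F → F hub ≡ 0ℚ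
  solution-hub {F} solves = identityˡ-unique (F hub) (F (inner zero)) (sym (begin
    F (inner zero)              ≡⟨ solves (inner zero) ⟩
    neighbourSum (inner zero) F ≡⟨ neighbourSum-inner zero F ⟩
    F hub + F (outer zero)      ≡⟨ cong (F hub +_) (solution-outer solves zero) ⟩
    F hub + F (inner zero)      ∎))

  solution-sum : ∀ {F} → IsSpiderSolution F → sumFin (suc d) (F ∘ inner) ≡ 0ℚ
  solution-sum {F} solves =
    trans (sym (trans (solves hub) (neighbourSum-hub F))) (solution-hub solves)

  solution-legs : ∀ {F} → IsSpiderSolution F → ∀ u → F u ≡ legs (F ∘ inner) u
  solution-legs solves hub       = solution-hub solves
  solution-legs solves (inner i) = refl
  solution-legs solves (outer i) = solution-outer solves i

  lincomb-legs : ∀ c (b : Fin d → Fin (suc d) → ℚ) u →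
    sumFin d (λ j → c j * legs (b j) u) ≡ legs (lincomb d c b) u
  lincomb-legs c b hub       = sumFin-zero d (λ j → ℚ.*-zeroʳ (c j))
  lincomb-legs c b (inner i) = refl
  lincomb-legs c b (outer i) = refl

  basis : Fin d → Fin N → ℚ
  basis j = legs (zeroSumBasis j) ∘ decode

  basis-independent : ∀ c → (∀ x → lincomb d c basis x ≡ 0ℚ) → ∀ j → c j ≡ 0ℚ
  basis-independent c c·b≡0 = zeroSumBasis-independent d c λ k → begin
    lincomb d c zeroSumBasis k
      ≡⟨ cong (legs (lincomb d c zeroSumBasis)) (decode-encode (inner k)) ⟨
    legs (lincomb d c zeroSumBasis) (decode (encode (inner k)))
      ≡⟨ lincomb-legs c zeroSumBasis (decode (encode (inner k))) ⟨
    lincomb d c basis (encode (inner k))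
      ≡⟨ c·b≡0 (encode (inner k)) ⟩
    0ℚ ∎

  basis-spans : ∀ f → IsSolution spider f →
    Σ (Fin d → ℚ) λ c → ∀ x → f x ≡ lincomb d c basis x
  basis-spans f solves = a ∘ suc , λ x → begin
    f x
      ≡⟨ cong f (encode-decode x) ⟨
    f (encode (decode x))
      ≡⟨ solution-legs solvesᵥ (decode x) ⟩
    legs a (decode x)
      ≡⟨ legs-cong (zeroSumBasis-spans d a (solution-sum solvesᵥ)) (decode x) ⟩
    legs (lincomb d (a ∘ suc) zeroSumBasis) (decode x)
      ≡⟨ lincomb-legs (a ∘ suc) zeroSumBasis (decode x) ⟨
    lincomb d (a ∘ suc) basis x ∎
    where
    a : Fin (suc d) → ℚ
    a i = f (encode (inner i))
    solvesᵥ : IsSpiderSolution (f ∘ encode)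
    solvesᵥ = solution-encode solves

  spider-dim : SolutionDim spider d
  spider-dim = basis , (λ j → solution-decode (legs-solution (sum-zeroSumBasis j)))
             , basis-independent , basis-spans

proposition3p5 : ∀ (d : ℕ) → 1 ≤ d →
    Σ ℕ λ n → Σ (Graph n) λ G → IsTree G × NSP G × SolutionDim G d
proposition3p5 (suc d) _ =
  N , spider , spider-tree , SolutionDim⇒NSP {G = spider} spider-dim , spider-dim
  where open SpiderSolutions (suc d)
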